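{- Let $n \ge 1$ and write $n = 2^j \cdot k$ with $j \ge 0$ and $k \ge 1$ odd. (1) If $j$ is even, then $C(n) = C(k)$. (2) If $j$ is odd, then $C(n) = C(2k) = 1 - C(k)$.
   Context: The function $C:\mathbb{Z}^+\to\{0,1\}$ is defined recursively by $C(1) = 0$, $C(n) = 1 - C(n-2)$ if $n > 1$ is odd, and $C(n) = 1 - C(n/2)$ if $n$ is even. -}

module Defs where

open import Data.Nat using (ℕ; zero; suc; _∸_; _*_; _^_; _/_)

data Parity : Set where
  even odd : Parity

parity : ℕ → Parity
parity zero = even
parity (suc zero) = odd
parity (suc (suc n)) = parity n

-- C(1) = 0
--   C(n) = 1 - C(n-2)   if n > 1 is odd
--   C(n) = 1 - C(n/2)   if n is even
-- With fuel f ≥ n the fuel never runs out (every recursive call strictly decreases n).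
-- The argument 0 is outside the domain; it gets the junk value 0 (never used below).
Cfuel : ℕ → ℕ → ℕ
Cfuel zero _ = 0
Cfuel (suc f) zero = 0
Cfuel (suc f) (suc zero) = 0
Cfuel (suc f) (suc (suc m)) with parity m
... | even = 1 ∸ Cfuel f (suc (suc m) / 2)
... | odd  = 1 ∸ Cfuel f m

C : ℕ → ℕ
C n = Cfuel n n

{-# OPTIONS --safe #-}
-- Doubling flips the value: C(2n) = 1 - C(n) for n ≥ 1, read straight off the
-- even clause of the definition. Since C takes values in {0,1}, two doublings
-- cancel, so C(2^j n) = C(n) or 1 - C(n) according to the parity of j.
module Submission where

open import Defs
open import Data.Nat using (ℕ; zero; suc; _∸_; _*_; _^_; _+_; _≤_; _≤′_; ≤′-refl; ≤′-step; z≤n; s≤s; _/_; NonZero)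
open import Data.Nat.Properties
open import Data.Nat.DivMod using (m/n<m; m*n/n≡m)
open import Data.Product using (_×_; _,_)
open import Relation.Binary.PropositionalEquality

Cfuel≤1 : ∀ f n → Cfuel f n ≤ 1
Cfuel≤1 zero n = z≤n
Cfuel≤1 (suc f) zero = z≤n
Cfuel≤1 (suc f) (suc zero) = z≤n
Cfuel≤1 (suc f) (suc (suc m)) with parity m
... | even = m∸n≤m 1 (Cfuel f (suc (suc m) / 2))
... | odd  = m∸n≤m 1 (Cfuel f m)

C≤1 : ∀ n → C n ≤ 1
C≤1 n = Cfuel≤1 n n

Cfuel-suc : ∀ {f n} → n ≤ f → Cfuel (suc f) n ≡ Cfuel f n
Cfuel-suc {zero}  {zero}        _           = refl
Cfuel-suc {suc f} {zero}        _           = refl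
Cfuel-suc {suc f} {suc zero}    _           = refl
Cfuel-suc {suc f} {suc (suc m)} (s≤s 1+m≤f) with parity m
... | even = cong (1 ∸_) (Cfuel-suc half≤f)
  where
  half≤f : suc (suc m) / 2 ≤ f
  half≤f = ≤-pred (≤-trans (m/n<m (suc (suc m)) 2 (s≤s (s≤s z≤n))) (s≤s 1+m≤f))
... | odd  = cong (1 ∸_) (Cfuel-suc (≤-trans (n≤1+n m) 1+m≤f))

Cfuel≡C : ∀ {f n} → n ≤ f → Cfuel f n ≡ C n
Cfuel≡C n≤f = go (≤⇒≤′ n≤f)
  where
  go : ∀ {f n} → n ≤′ f → Cfuel f n ≡ C n
  go ≤′-refl        = refl
  go (≤′-step n≤′f) = trans (Cfuel-suc (≤′⇒≤ n≤′f)) (go n≤′f)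

Cfuel-unfold-even : ∀ f m → parity m ≡ even →
                    Cfuel (suc f) (suc (suc m)) ≡ 1 ∸ Cfuel f (suc (suc m) / 2)
Cfuel-unfold-even f m p rewrite p = refl

parity[m+m]≡even : ∀ m → parity (m + m) ≡ even
parity[m+m]≡even zero    = refl
parity[m+m]≡even (suc m) rewrite +-suc m m = parity[m+m]≡even m

2*[1+m]≡2+[m+m] : ∀ m → 2 * suc m ≡ 2 + (m + m)
2*[1+m]≡2+[m+m] m = cong suc (trans (cong (m +_) (+-identityʳ (suc m))) (+-suc m m))

[2+[m+m]]/2≡1+m : ∀ m → (2 + (m + m)) / 2 ≡ suc m
[2+[m+m]]/2≡1+m m = begin
  (2 + (m + m)) / 2 ≡⟨ cong (_/ 2) (sym (2*[1+m]≡2+[m+m] m)) ⟩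
  (2 * suc m) / 2   ≡⟨ cong (_/ 2) (*-comm 2 (suc m)) ⟩
  (suc m * 2) / 2   ≡⟨ m*n/n≡m (suc m) 2 ⟩
  suc m             ∎
  where open ≡-Reasoning

C[2*n]≡1∸C[n] : ∀ n .{{_ : NonZero n}} → C (2 * n) ≡ 1 ∸ C n
C[2*n]≡1∸C[n] (suc m) = begin
  C (2 * suc m)                                   ≡⟨ cong C (2*[1+m]≡2+[m+m] m) ⟩
  Cfuel (2 + (m + m)) (2 + (m + m))               ≡⟨ Cfuel-unfold-even (suc (m + m)) (m + m) (parity[m+m]≡even m) ⟩
  1 ∸ Cfuel (suc (m + m)) ((2 + (m + m)) / 2)     ≡⟨ cong (λ x → 1 ∸ Cfuel (suc (m + m)) x) ([2+[m+m]]/2≡1+m m) ⟩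
  1 ∸ Cfuel (suc (m + m)) (suc m)                 ≡⟨ cong (1 ∸_) (Cfuel≡C (s≤s (m≤m+n m m))) ⟩
  1 ∸ C (suc m)                                   ∎
  where open ≡-Reasoning

C[2^[1+j]*n]≡1∸C[2^j*n] : ∀ j n .{{_ : NonZero n}} → C (2 ^ suc j * n) ≡ 1 ∸ C (2 ^ j * n)
C[2^[1+j]*n]≡1∸C[2^j*n] j n = begin
  C (2 ^ suc j * n)   ≡⟨ cong C (*-assoc 2 (2 ^ j) n) ⟩
  C (2 * (2 ^ j * n)) ≡⟨ C[2*n]≡1∸C[n] (2 ^ j * n) ⟩
  1 ∸ C (2 ^ j * n)   ∎
  where
  open ≡-Reasoning
  instance _ = m*n≢0 (2 ^ j) n {{m^n≢0 2 j}}

C[2^[2+j]*n]≡C[2^j*n] : ∀ j n .{{_ : NonZero n}} → C (2 ^ (2 + j) * n) ≡ C (2 ^ j * n)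
C[2^[2+j]*n]≡C[2^j*n] j n = begin
  C (2 ^ (2 + j) * n)     ≡⟨ C[2^[1+j]*n]≡1∸C[2^j*n] (suc j) n ⟩
  1 ∸ C (2 ^ suc j * n)   ≡⟨ cong (1 ∸_) (C[2^[1+j]*n]≡1∸C[2^j*n] j n) ⟩
  1 ∸ (1 ∸ C (2 ^ j * n)) ≡⟨ m∸[m∸n]≡n (C≤1 (2 ^ j * n)) ⟩
  C (2 ^ j * n)           ∎
  where open ≡-Reasoning

C[2^j*n]≡C[n] : ∀ j n .{{_ : NonZero n}} → parity j ≡ even → C (2 ^ j * n) ≡ C n
C[2^j*n]≡C[n] zero          n _ = cong C (*-identityˡ n)
C[2^j*n]≡C[n] (suc (suc j)) n p = trans (C[2^[2+j]*n]≡C[2^j*n] j n) (C[2^j*n]≡C[n] j n p)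

C[2^j*n]≡1∸C[n] : ∀ j n .{{_ : NonZero n}} → parity j ≡ odd → C (2 ^ j * n) ≡ 1 ∸ C n
C[2^j*n]≡1∸C[n] (suc zero)    n _ = trans (C[2^[1+j]*n]≡1∸C[2^j*n] 0 n) (cong (λ x → 1 ∸ C x) (*-identityˡ n))
C[2^j*n]≡1∸C[n] (suc (suc j)) n p = trans (C[2^[2+j]*n]≡C[2^j*n] j n) (C[2^j*n]≡1∸C[n] j n p)

proposition2p2 : (j k : ℕ) → parity k ≡ odd →
    (parity j ≡ even → C (2 ^ j * k) ≡ C k) ×
    (parity j ≡ odd → (C (2 ^ j * k) ≡ C (2 * k)) × (C (2 * k) ≡ 1 ∸ C k))
proposition2p2 j (suc k) _ =
  C[2^j*n]≡C[n] j (suc k) ,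
  λ p → trans (C[2^j*n]≡1∸C[n] j (suc k) p) (sym (C[2*n]≡1∸C[n] (suc k))) , C[2*n]≡1∸C[n] (suc k)
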